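{- For every positive integer $n$ and every $\pi\in\mathfrak{S}_n$, $\operatorname{EV}(\Theta(\pi))=\operatorname{Des}(\pi)$.
   Context: For $\pi=a_1\cdots a_n\in\mathfrak{S}_n$, $\operatorname{Des}(\pi)=\{i\in[n-1]:a_i>a_{i+1}\}$. The increasing unordered tree $T'(\pi)$ has root labeled $0$ and vertex set $\{0\}\cup[n]$: a letter $b$ that is a right-to-left minimum of $\pi$ is a child of the root; otherwise $b$ is a child of the leftmost letter $a$ to the right of $b$ with $a<b$. $\operatorname{EV}(\pi)$ is the set of indices $1\le i\le n$ such that the vertex $a_i$ has even distance from the root in $T'(\pi)$. The complement $\pi^c$ of a word $\pi=a_1\cdots a_n$ with distinct letters is the word $b_1\cdots b_n$ on the same set of letters such that $a_i<a_j$ iff $b_i>b_j$. The map $\Theta$ on words with distinct letters from $\{1,2,\ldots\}$ is defined recursively: $\Theta$ of the empty word is empty; if $\pi=\sigma m\tau$ with $m$ the smallest letter of $\pi$, then $\Theta(\pi)=\Theta(\sigma^c)\,m\,\Theta(\tau)$. -}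

module Defs where

open import Data.Nat using (ℕ; zero; suc; _∸_; _<ᵇ_; _≡ᵇ_)
open import Data.Nat.Properties using ()
open import Data.Bool using (Bool; true; false; if_then_else_)
open import Data.List using (List; []; _∷_; _++_; length; map; upTo; zip; foldr)
open import Data.Maybe using (Maybe; just; nothing)
open import Data.Product using (_×_; _,_)
open import Data.Nat.Base using (_%_)

-- Words are lists of natural numbers (letters from {1,2,...}, assumed distinct).
-- A permutation of [n] is a list that is a rearrangement of 1 2 ... n.

rank : List ℕ → ℕ → ℕ
rank []       a = 0
rank (x ∷ xs) a = if x <ᵇ a then suc (rank xs a) else rank xs a

letterOfRank : List ℕ → List ℕ → ℕ → ℕ
letterOfRank w []       r = 0
letterOfRank w (x ∷ xs) r = if rank w x ≡ᵇ r then x else letterOfRank w xs r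

-- complement: same letter set, order reversed (a_i < a_j iff b_i > b_j)
complement : List ℕ → List ℕ
complement w = map (λ a → letterOfRank w w ((length w ∸ 1) ∸ rank w a)) w

minimum : List ℕ → Maybe ℕ
minimum []       = nothing
minimum (x ∷ xs) with minimum xs
... | nothing = just x
... | just m  = just (if x <ᵇ m then x else m)

splitAtLetter : ℕ → List ℕ → List ℕ × List ℕ
splitAtLetter m []       = [] , []
splitAtLetter m (x ∷ xs) with x ≡ᵇ m
... | true  = [] , xs
... | false with splitAtLetter m xs
...   | σ , τ = (x ∷ σ) , τ

-- Θ with fuel (fuel = length suffices, since σ and τ are strictly shorter)
Θ-fuel : ℕ → List ℕ → List ℕ
Θ-fuel zero    w = []
Θ-fuel (suc f) w with minimum w
... | nothing = []
... | just m with splitAtLetter m w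
...   | σ , τ = Θ-fuel f (complement σ) ++ (m ∷ Θ-fuel f τ)

Θ : List ℕ → List ℕ
Θ w = Θ-fuel (length w) w

-- depth in T'(π) of each position: a letter b whose right has no smaller
-- letter is a child of root (depth 1); otherwise it is a child of the leftmost
-- smaller letter to its right.
firstSmaller : ℕ → List ℕ → List ℕ → Maybe ℕ
firstSmaller b []       _        = nothing
firstSmaller b (x ∷ xs) []       = nothing
firstSmaller b (x ∷ xs) (d ∷ ds) = if x <ᵇ b then just d else firstSmaller b xs ds

depths : List ℕ → List ℕ
depths []       = []
depths (x ∷ xs) with depths xs
... | ds with firstSmaller x xs ds
...   | nothing = 1 ∷ ds
...   | just d  = suc d ∷ ds

isEven : ℕ → Bool
isEven k = k % 2 ≡ᵇ 0

indexed : List ℕ → List (ℕ × ℕ)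
indexed w = zip (map suc (upTo (length w))) w

filterIdx : List (ℕ × Bool) → List ℕ
filterIdx []               = []
filterIdx ((i , true) ∷ r)  = i ∷ filterIdx r
filterIdx ((i , false) ∷ r) = filterIdx r

EV : List ℕ → List ℕ
EV w = filterIdx (zip (map suc (upTo (length w))) (map isEven (depths w)))

descFlags : List ℕ → List Bool
descFlags []           = []
descFlags (x ∷ [])     = []
descFlags (x ∷ y ∷ ys) = (y <ᵇ x) ∷ descFlags (y ∷ ys)

Des : List ℕ → List ℕ
Des w = filterIdx (zip (map suc (upTo (length w))) (descFlags w))

-- Write π = σ m τ with m its smallest letter, so that Θ(π) = Θ(σᶜ) m Θ(τ). In the tree of Θ(π), m is a
-- child of the root, the letters of Θ(τ) keep their depths from the tree of Θ(τ), and those of Θ(σᶜ)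
-- sit one level deeper than in the tree of Θ(σᶜ), since m is the first smaller letter to the right of
-- any letter of Θ(σᶜ) that has none inside Θ(σᶜ). By induction, the even-depth positions of Θ(π) are
-- therefore the non-descents of σᶜ, then nothing at m, then the descents of τ. As complementation
-- reverses comparisons, the non-descents of σᶜ are the descents of σ, where the last letter of σ, a
-- descent of π because it exceeds m, corresponds to the last letter of σᶜ, never a descent of σᶜ.
module Submission where

open import Defs
open import Data.Nat using (ℕ; zero; suc; _≤_; _<_; _<ᵇ_; _≡ᵇ_; _∸_; z≤n; s≤s)
open import Data.Nat.Properties
open import Data.Bool using (Bool; true; false; not; T)
open import Data.List using (List; []; _∷_; _++_; length; map; upTo; zip)
open import Data.List.Properties
  using (map-++; map-∘; map-cong; length-map; length-++-sucʳ; length-++-≤ˡ; length-++-≤ʳ)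
open import Data.List.Membership.Propositional using (_∈_)
open import Data.List.Membership.Propositional.Properties using (∈-insert; ∈-map⁻)
open import Data.List.Relation.Unary.Any using (here; there)
open import Data.List.Relation.Unary.All as All using (All; []; _∷_)
import Data.List.Relation.Unary.All.Properties as All
open import Data.List.Relation.Unary.AllPairs as AllPairs using ([]; _∷_)
open import Data.List.Relation.Unary.Unique.Propositional using (Unique)
import Data.List.Relation.Unary.Unique.Propositional.Properties as Unique
open import Data.List.Relation.Binary.Subset.Propositional using (_⊆_)
open import Data.List.Relation.Binary.Subset.Propositional.Properties using (⊆-trans; ++⁺; ∷⁺ʳ; All-resp-⊇)
open import Data.List.Relation.Binary.Permutation.Propositional using (_↭_; ↭-sym; ↭⇒↭ₛ)
open import Relation.Binary.PropositionalEquality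
  using (_≡_; _≢_; refl; sym; trans; cong; cong₂; subst; setoid; module ≡-Reasoning)
open import Data.List.Relation.Binary.Permutation.Setoid.Properties (setoid ℕ) using (Unique-resp-↭)
open import Data.Maybe using (Maybe; just; nothing)
open import Data.Product using (∃-syntax; _×_; _,_; proj₁; proj₂)
import Data.Product as Product
open import Function using (_∘_)
open import Relation.Binary.Definitions using (tri<; tri≈; tri>)
open import Relation.Nullary using (contradiction)
open import Relation.Nullary.Reflects using (ofʸ; ofⁿ)

open ≡-Reasoning

<⇒<ᵇ≡true : ∀ {m n} → m < n → (m <ᵇ n) ≡ true
<⇒<ᵇ≡true {m} {n} m<n with m <ᵇ n | <ᵇ-reflects-< m n
... | true  | _        = refl
... | false | ofⁿ m≮n = contradiction m<n m≮n

≥⇒<ᵇ≡false : ∀ {m n} → n ≤ m → (m <ᵇ n) ≡ false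
≥⇒<ᵇ≡false {m} {n} n≤m with m <ᵇ n | <ᵇ-reflects-< m n
... | true  | ofʸ m<n = contradiction n≤m (<⇒≱ m<n)
... | false | _       = refl

Unique-++⁻ : ∀ {A : Set} (xs : List A) {ys} → Unique (xs ++ ys) → Unique xs × Unique ys
Unique-++⁻ []       u          = [] , u
Unique-++⁻ (x ∷ xs) (x∉ ∷ u) =
  (proj₁ (All.++⁻ xs x∉) ∷ proj₁ (Unique-++⁻ xs u)) , proj₂ (Unique-++⁻ xs u)

StrictlyAntitoneOn : List ℕ → (ℕ → ℕ) → Set
StrictlyAntitoneOn l g = ∀ {x y} → x ∈ l → y ∈ l → x < y → g y < g x

antitoneOn⇒injectiveOn : ∀ {l g} → StrictlyAntitoneOn l g →
                         ∀ {x y} → x ∈ l → y ∈ l → g x ≡ g y → x ≡ y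
antitoneOn⇒injectiveOn anti {x} {y} x∈ y∈ gx≡gy with <-cmp x y
... | tri< x<y _ _ = contradiction (sym gx≡gy) (<⇒≢ (anti x∈ y∈ x<y))
... | tri≈ _ x≡y _ = x≡y
... | tri> _ _ y<x = contradiction gx≡gy (<⇒≢ (anti y∈ x∈ y<x))

Unique-map-antitoneOn : ∀ {l g} → StrictlyAntitoneOn l g → Unique l → Unique (map g l)
Unique-map-antitoneOn {[]}    anti []         = []
Unique-map-antitoneOn {x ∷ l} anti (x∉l ∷ u) =
  All.map⁺ (All.tabulate λ y∈l gx≡gy →
              All.lookup x∉l y∈l (antitoneOn⇒injectiveOn anti (here refl) (there y∈l) gx≡gy))
  ∷ Unique-map-antitoneOn (λ p q → anti (there p) (there q)) u

<ᵇ-antitoneOn : ∀ {l g} → StrictlyAntitoneOn l g → ∀ {x y} → x ∈ l → y ∈ l → x ≢ y →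
                (y <ᵇ x) ≡ not (g y <ᵇ g x)
<ᵇ-antitoneOn anti {x} {y} x∈ y∈ x≢y with <-cmp x y
... | tri< x<y _ _ rewrite ≥⇒<ᵇ≡false (<⇒≤ x<y) | <⇒<ᵇ≡true (anti x∈ y∈ x<y) = refl
... | tri≈ _ x≡y _ = contradiction x≡y x≢y
... | tri> _ _ y<x rewrite <⇒<ᵇ≡true y<x | ≥⇒<ᵇ≡false (<⇒≤ (anti y∈ x∈ y<x)) = refl

rank-mono-≤ : ∀ w {a b} → a ≤ b → rank w a ≤ rank w b
rank-mono-≤ []       _   = z≤n
rank-mono-≤ (x ∷ xs) {a} {b} a≤b with x <ᵇ a | <ᵇ-reflects-< x a | x <ᵇ b | <ᵇ-reflects-< x b
... | true  | _       | true  | _       = s≤s (rank-mono-≤ xs a≤b)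
... | true  | ofʸ x<a | false | ofⁿ x≮b = contradiction (<-≤-trans x<a a≤b) x≮b
... | false | _       | true  | _       = m≤n⇒m≤1+n (rank-mono-≤ xs a≤b)
... | false | _       | false | _       = rank-mono-≤ xs a≤b

rank-∷-< : ∀ {x a} xs → x < a → rank (x ∷ xs) a ≡ suc (rank xs a)
rank-∷-< {x} {a} _ x<a rewrite <⇒<ᵇ≡true x<a = refl

rank-∷-≥ : ∀ {x a} xs → a ≤ x → rank (x ∷ xs) a ≡ rank xs a
rank-∷-≥ {x} {a} _ a≤x rewrite ≥⇒<ᵇ≡false a≤x = refl

rank-mono-< : ∀ w {a b} → a ∈ w → a < b → rank w a < rank w b
rank-mono-< (x ∷ xs) {a} {b} (here refl) a<b
  rewrite rank-∷-≥ xs (≤-refl {a}) | rank-∷-< xs a<b = s≤s (rank-mono-≤ xs (<⇒≤ a<b))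
rank-mono-< (x ∷ xs) {a} {b} (there a∈xs) a<b with x <ᵇ a | <ᵇ-reflects-< x a | x <ᵇ b | <ᵇ-reflects-< x b
... | true  | _       | true  | _       = s≤s (rank-mono-< xs a∈xs a<b)
... | true  | ofʸ x<a | false | ofⁿ x≮b = contradiction (<-trans x<a a<b) x≮b
... | false | _       | true  | _       = s≤s (<⇒≤ (rank-mono-< xs a∈xs a<b))
... | false | _       | false | _       = rank-mono-< xs a∈xs a<b

rank-≤-length : ∀ w a → rank w a ≤ length w
rank-≤-length []       a = z≤n
rank-≤-length (x ∷ xs) a with x <ᵇ a
... | true  = s≤s (rank-≤-length xs a)
... | false = m≤n⇒m≤1+n (rank-≤-length xs a)

rank-<-length : ∀ w {a} → a ∈ w → rank w a < length w
rank-<-length (x ∷ xs) {a} (here refl) rewrite rank-∷-≥ xs (≤-refl {a}) = s≤s (rank-≤-length xs a)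
rank-<-length (x ∷ xs) {a} (there a∈xs) with x <ᵇ a
... | true  = s≤s (rank-<-length xs a∈xs)
... | false = m≤n⇒m≤1+n (rank-<-length xs a∈xs)

rank-surjective : ∀ w → Unique w → ∀ {r} → r < length w → ∃[ a ] a ∈ w × rank w a ≡ r
rank-surjective (x ∷ xs) (x∉xs ∷ u) {r} r<len with <-cmp r (rank xs x)
... | tri≈ _ r≡k _ = x , here refl , trans (rank-∷-≥ xs (≤-refl {x})) (sym r≡k)
... | tri< r<k _ _ with rank-surjective xs u (<-≤-trans r<k (rank-≤-length xs x))
...   | a , a∈xs , ra≡r = a , there a∈xs , trans (rank-∷-≥ xs a≤x) ra≡r
  where
  a≤x : a ≤ x
  a≤x = ≮⇒≥ (λ x<a → <⇒≱ r<k (subst (rank xs x ≤_) ra≡r (rank-mono-≤ xs (<⇒≤ x<a))))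
rank-surjective (x ∷ xs) (x∉xs ∷ u) {suc r} (s≤s r<len) | tri> _ _ k<r
  with rank-surjective xs u r<len
... | a , a∈xs , ra≡r = a , there a∈xs , trans (rank-∷-< xs x<a) (cong suc ra≡r)
  where
  x<a : x < a
  x<a = ≤∧≢⇒< (≮⇒≥ λ a<x → <⇒≱ (subst (_< rank xs x) ra≡r (rank-mono-< xs a∈xs a<x)) (≤-pred k<r))
              (All.lookup x∉xs a∈xs)

letterOfRank-spec : ∀ w l {a r} → a ∈ l → rank w a ≡ r →
                    letterOfRank w l r ∈ l × rank w (letterOfRank w l r) ≡ r
letterOfRank-spec w (x ∷ l) {a} {r} a∈ ra≡r with rank w x ≡ᵇ r in eq
... | true  = here refl , ≡ᵇ⇒≡ (rank w x) r (subst T (sym eq) _)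
... | false with a∈
...   | here refl = contradiction (≡⇒≡ᵇ (rank w a) r ra≡r) (subst T eq)
...   | there a∈l = Product.map₁ there (letterOfRank-spec w l a∈l ra≡r)

mirror : List ℕ → ℕ → ℕ
mirror w a = letterOfRank w w ((length w ∸ 1) ∸ rank w a)

mirror-spec : ∀ {w} → Unique w → ∀ {a} → a ∈ w →
              mirror w a ∈ w × rank w (mirror w a) ≡ (length w ∸ 1) ∸ rank w a
mirror-spec {w@(_ ∷ xs)} u {a} _ =
  let b , b∈w , rb≡r = rank-surjective w u (s≤s (m∸n≤m (length xs) (rank w a)))
  in  letterOfRank-spec w w b∈w rb≡r

mirror-antitone : ∀ {w} → Unique w → StrictlyAntitoneOn w (mirror w)
mirror-antitone {w@(_ ∷ _)} u {a} {b} a∈w b∈w a<b =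
  ≰⇒> (λ ma≤mb → <⇒≱ rank-mb<rank-ma (rank-mono-≤ w ma≤mb))
  where
  rank-mb<rank-ma : rank w (mirror w b) < rank w (mirror w a)
  rank-mb<rank-ma rewrite proj₂ (mirror-spec u a∈w) | proj₂ (mirror-spec u b∈w) =
    ∸-monoʳ-< (rank-mono-< w a∈w a<b) (≤-pred (rank-<-length w b∈w))

complement-⊆ : ∀ {w} → Unique w → complement w ⊆ w
complement-⊆ {w} u b∈ with ∈-map⁻ (mirror w) b∈
... | a , a∈w , refl = proj₁ (mirror-spec u a∈w)

complement-Unique : ∀ {w} → Unique w → Unique (complement w)
complement-Unique u = Unique-map-antitoneOn (mirror-antitone u) u

-- The last flag records whether the last letter is followed by a smaller one in an enclosing word.
descFlagsEndingWith : Bool → List ℕ → List Bool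
descFlagsEndingWith b []           = []
descFlagsEndingWith b (x ∷ [])     = b ∷ []
descFlagsEndingWith b (x ∷ y ∷ ys) = (y <ᵇ x) ∷ descFlagsEndingWith b (y ∷ ys)

descFlagsEndingWith-∷ : ∀ b x xs → descFlagsEndingWith b (x ∷ xs) ≡ descFlags (x ∷ xs) ++ b ∷ []
descFlagsEndingWith-∷ b x []       = refl
descFlagsEndingWith-∷ b x (y ∷ ys) = cong ((y <ᵇ x) ∷_) (descFlagsEndingWith-∷ b y ys)

length-descFlagsEndingWith : ∀ b w → length (descFlagsEndingWith b w) ≡ length w
length-descFlagsEndingWith b []           = refl
length-descFlagsEndingWith b (x ∷ [])     = refl
length-descFlagsEndingWith b (x ∷ y ∷ ys) = cong suc (length-descFlagsEndingWith b (y ∷ ys))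

descFlagsEndingWith-minimum-∷ : ∀ {m} τ → All (m <_) τ →
  descFlagsEndingWith false (m ∷ τ) ≡ false ∷ descFlagsEndingWith false τ
descFlagsEndingWith-minimum-∷ []      _           = refl
descFlagsEndingWith-minimum-∷ (t ∷ τ) (m<t ∷ _) =
  cong (_∷ descFlagsEndingWith false (t ∷ τ)) (≥⇒<ᵇ≡false (<⇒≤ m<t))

descFlagsEndingWith-++-minimum : ∀ {m} σ τ → All (m <_) σ → All (m <_) τ →
  descFlagsEndingWith false (σ ++ m ∷ τ) ≡ descFlagsEndingWith true σ ++ false ∷ descFlagsEndingWith false τ
descFlagsEndingWith-++-minimum []           τ _           m<τ = descFlagsEndingWith-minimum-∷ τ m<τ
descFlagsEndingWith-++-minimum (x ∷ [])     τ (m<x ∷ _)  m<τ =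
  cong₂ _∷_ (<⇒<ᵇ≡true m<x) (descFlagsEndingWith-minimum-∷ τ m<τ)
descFlagsEndingWith-++-minimum (x ∷ y ∷ σ) τ (_ ∷ m<σ) m<τ =
  cong ((y <ᵇ x) ∷_) (descFlagsEndingWith-++-minimum (y ∷ σ) τ m<σ m<τ)

descFlagsEndingWith-antitone : ∀ {l g} → StrictlyAntitoneOn l g → Unique l →
  descFlagsEndingWith true l ≡ map not (descFlagsEndingWith false (map g l))
descFlagsEndingWith-antitone {[]}         _ _ = refl
descFlagsEndingWith-antitone {x ∷ []}     _ _ = refl
descFlagsEndingWith-antitone {x ∷ y ∷ l} anti ((x≢y ∷ _) ∷ u) =
  cong₂ _∷_ (<ᵇ-antitoneOn anti (here refl) (there (here refl)) x≢y)
            (descFlagsEndingWith-antitone (λ p q → anti (there p) (there q)) u)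

filterIdx-zip-∷ʳ-false : ∀ is fs → filterIdx (zip is (fs ++ false ∷ [])) ≡ filterIdx (zip is fs)
filterIdx-zip-∷ʳ-false []           fs           = refl
filterIdx-zip-∷ʳ-false (i ∷ [])     []           = refl
filterIdx-zip-∷ʳ-false (i ∷ j ∷ is) []           = refl
filterIdx-zip-∷ʳ-false (i ∷ is)     (true ∷ fs)  = cong (i ∷_) (filterIdx-zip-∷ʳ-false is fs)
filterIdx-zip-∷ʳ-false (i ∷ is)     (false ∷ fs) = filterIdx-zip-∷ʳ-false is fs

filterIdx-descFlagsEndingWith-false : ∀ is w →
  filterIdx (zip is (descFlagsEndingWith false w)) ≡ filterIdx (zip is (descFlags w))
filterIdx-descFlagsEndingWith-false is []       = refl
filterIdx-descFlagsEndingWith-false is (x ∷ xs) rewrite descFlagsEndingWith-∷ false x xs =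
  filterIdx-zip-∷ʳ-false is (descFlags (x ∷ xs))

depthBelow : Maybe ℕ → ℕ
depthBelow nothing  = 1
depthBelow (just d) = suc d

depths-∷ : ∀ x xs → depths (x ∷ xs) ≡ depthBelow (firstSmaller x xs (depths xs)) ∷ depths xs
depths-∷ x xs with depths xs
... | ds with firstSmaller x xs ds
...   | nothing = refl
...   | just _  = refl

length-depths : ∀ w → length (depths w) ≡ length w
length-depths []       = refl
length-depths (x ∷ xs) = trans (cong length (depths-∷ x xs)) (cong suc (length-depths xs))

firstSmaller-minimum : ∀ {m} β ds → All (m <_) β → firstSmaller m β ds ≡ nothing
firstSmaller-minimum []      ds       _            = refl
firstSmaller-minimum (b ∷ β) []       _            = refl
firstSmaller-minimum (b ∷ β) (d ∷ ds) (m<b ∷ m<β) rewrite ≥⇒<ᵇ≡false (<⇒≤ m<b) =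
  firstSmaller-minimum β ds m<β

firstSmaller-++-minimum : ∀ {m x} α dα β dβ → length dα ≡ length α → m < x →
  firstSmaller x (α ++ m ∷ β) (map suc dα ++ 1 ∷ dβ) ≡ just (depthBelow (firstSmaller x α dα))
firstSmaller-++-minimum []      []        β dβ _ m<x rewrite <⇒<ᵇ≡true m<x = refl
firstSmaller-++-minimum {x = x} (a ∷ α) (d ∷ dα) β dβ |dα|≡|α| m<x with a <ᵇ x
... | true  = refl
... | false = firstSmaller-++-minimum α dα β dβ (suc-injective |dα|≡|α|) m<x

depths-++-minimum : ∀ {m} α β → All (m <_) α → All (m <_) β →
  depths (α ++ m ∷ β) ≡ map suc (depths α) ++ 1 ∷ depths β
depths-++-minimum {m} [] β _ m<β = begin
  depths (m ∷ β)
    ≡⟨ depths-∷ m β ⟩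
  depthBelow (firstSmaller m β (depths β)) ∷ depths β
    ≡⟨ cong (λ p → depthBelow p ∷ depths β) (firstSmaller-minimum β (depths β) m<β) ⟩
  1 ∷ depths β
    ∎
depths-++-minimum {m} (a ∷ α) β (m<a ∷ m<α) m<β = begin
  depths (a ∷ α ++ m ∷ β)
    ≡⟨ depths-∷ a (α ++ m ∷ β) ⟩
  depthBelow (firstSmaller a (α ++ m ∷ β) (depths (α ++ m ∷ β))) ∷ depths (α ++ m ∷ β)
    ≡⟨ cong (λ ds → depthBelow (firstSmaller a (α ++ m ∷ β) ds) ∷ ds)
            (depths-++-minimum α β m<α m<β) ⟩
  depthBelow (firstSmaller a (α ++ m ∷ β) (map suc (depths α) ++ 1 ∷ depths β))
    ∷ map suc (depths α) ++ 1 ∷ depths β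
    ≡⟨ cong (λ p → depthBelow p ∷ map suc (depths α) ++ 1 ∷ depths β)
            (firstSmaller-++-minimum α (depths α) β (depths β) (length-depths α) m<a) ⟩
  map suc (depthBelow (firstSmaller a α (depths α)) ∷ depths α) ++ 1 ∷ depths β
    ≡⟨ cong (λ ds → map suc ds ++ 1 ∷ depths β) (depths-∷ a α) ⟨
  map suc (depths (a ∷ α)) ++ 1 ∷ depths β
    ∎

evenDepthFlags : List ℕ → List Bool
evenDepthFlags w = map isEven (depths w)

isEven-suc : ∀ k → isEven (suc k) ≡ not (isEven k)
isEven-suc zero          = refl
isEven-suc (suc zero)    = refl
isEven-suc (suc (suc k)) = isEven-suc k

evenDepthFlags-++-minimum : ∀ {m} α β → All (m <_) α → All (m <_) β →
  evenDepthFlags (α ++ m ∷ β) ≡ map not (evenDepthFlags α) ++ false ∷ evenDepthFlags β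
evenDepthFlags-++-minimum {m} α β m<α m<β = begin
  map isEven (depths (α ++ m ∷ β))
    ≡⟨ cong (map isEven) (depths-++-minimum α β m<α m<β) ⟩
  map isEven (map suc (depths α) ++ 1 ∷ depths β)
    ≡⟨ map-++ isEven (map suc (depths α)) (1 ∷ depths β) ⟩
  map isEven (map suc (depths α)) ++ false ∷ evenDepthFlags β
    ≡⟨ cong (_++ false ∷ evenDepthFlags β) parity-flip ⟩
  map not (evenDepthFlags α) ++ false ∷ evenDepthFlags β
    ∎
  where
  parity-flip : map isEven (map suc (depths α)) ≡ map not (evenDepthFlags α)
  parity-flip = begin
    map isEven (map suc (depths α)) ≡⟨ map-∘ (depths α) ⟨
    map (isEven ∘ suc) (depths α)   ≡⟨ map-cong isEven-suc (depths α) ⟩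
    map (not ∘ isEven) (depths α)   ≡⟨ map-∘ (depths α) ⟩
    map not (evenDepthFlags α)      ∎

minimum-spec : ∀ x xs → ∃[ m ] minimum (x ∷ xs) ≡ just m × m ∈ x ∷ xs × All (m ≤_) (x ∷ xs)
minimum-spec x [] = x , refl , here refl , ≤-refl ∷ []
minimum-spec x (y ∷ ys) with minimum (y ∷ ys) | minimum-spec y ys
... | .(just m) | m , refl , m∈ , m≤ with x <ᵇ m | <ᵇ-reflects-< x m
...   | true  | ofʸ x<m = x , refl , here refl , ≤-refl ∷ All.map (≤-trans (<⇒≤ x<m)) m≤
...   | false | ofⁿ x≮m = m , refl , there m∈ , ≮⇒≥ x≮m ∷ m≤

splitAtLetter-++ : ∀ {m} w → m ∈ w → w ≡ proj₁ (splitAtLetter m w) ++ m ∷ proj₂ (splitAtLetter m w)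
splitAtLetter-++ {m} (x ∷ xs) m∈ with x ≡ᵇ m in eq | m∈
... | true  | _          = cong (_∷ xs) (≡ᵇ⇒≡ x m (subst T (sym eq) _))
... | false | here refl  = contradiction (≡⇒≡ᵇ x x refl) (subst T eq)
... | false | there m∈xs = cong (x ∷_) (splitAtLetter-++ xs m∈xs)

Θ-fuel-suc : ∀ f {w m} → minimum w ≡ just m →
  Θ-fuel (suc f) w ≡
    Θ-fuel f (complement (proj₁ (splitAtLetter m w))) ++ m ∷ Θ-fuel f (proj₂ (splitAtLetter m w))
Θ-fuel-suc f {w} {m} min≡ rewrite min≡ with splitAtLetter m w
... | σ , τ = refl

All≤∧Unique⇒All< : ∀ {m} σ τ → Unique (σ ++ m ∷ τ) → All (m ≤_) (σ ++ m ∷ τ) →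
                   All (m <_) σ × All (m <_) τ
All≤∧Unique⇒All< []      τ (m∉τ ∷ _) (_ ∷ m≤τ) =
  [] , All.zipWith (λ (m≤t , m≢t) → ≤∧≢⇒< m≤t m≢t) (m≤τ , m∉τ)
All≤∧Unique⇒All< (x ∷ σ) τ (x∉ ∷ u)  (m≤x ∷ m≤) =
  Product.map₁ (≤∧≢⇒< m≤x (All.lookup x∉ (∈-insert σ) ∘ sym) ∷_) (All≤∧Unique⇒All< σ τ u m≤)

data MinimumSplit : List ℕ → Set where
  empty : MinimumSplit []
  split : ∀ σ m τ → All (m <_) σ → All (m <_) τ → Unique σ → Unique τ →
          (∀ f → Θ-fuel (suc f) (σ ++ m ∷ τ) ≡ Θ-fuel f (complement σ) ++ m ∷ Θ-fuel f τ) →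
          MinimumSplit (σ ++ m ∷ τ)

minimumSplit : ∀ w → Unique w → MinimumSplit w
minimumSplit [] _ = empty
minimumSplit w@(x ∷ xs) u with minimum-spec x xs
... | m , min≡ , m∈w , m≤w =
  subst MinimumSplit (sym w≡) (split σ m τ (proj₁ m<σ×m<τ) (proj₂ m<σ×m<τ) uσ uτ unfold)
  where
  σ = proj₁ (splitAtLetter m w)
  τ = proj₂ (splitAtLetter m w)
  w≡ : w ≡ σ ++ m ∷ τ
  w≡ = splitAtLetter-++ w m∈w
  u′ : Unique (σ ++ m ∷ τ)
  u′ = subst Unique w≡ u
  m<σ×m<τ : All (m <_) σ × All (m <_) τ
  m<σ×m<τ = All≤∧Unique⇒All< σ τ u′ (subst (All (m ≤_)) w≡ m≤w)
  uσ : Unique σ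
  uσ = proj₁ (Unique-++⁻ σ u′)
  uτ : Unique τ
  uτ = AllPairs.tail (proj₂ (Unique-++⁻ σ u′))
  unfold : ∀ f → Θ-fuel (suc f) (σ ++ m ∷ τ) ≡ Θ-fuel f (complement σ) ++ m ∷ Θ-fuel f τ
  unfold f = trans (cong (Θ-fuel (suc f)) (sym w≡)) (Θ-fuel-suc f min≡)

Θ-fuel-⊆ : ∀ f w → Unique w → Θ-fuel f w ⊆ w
Θ-fuel-complement-⊆ : ∀ f w → Unique w → Θ-fuel f (complement w) ⊆ w

Θ-fuel-⊆ zero    w _ ()
Θ-fuel-⊆ (suc f) w u with minimumSplit w u
... | empty = λ ()
... | split σ m τ _ _ uσ uτ unfold = subst (_⊆ σ ++ m ∷ τ) (sym (unfold f))
        (++⁺ (Θ-fuel-complement-⊆ f σ uσ) (∷⁺ʳ m (Θ-fuel-⊆ f τ uτ)))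

Θ-fuel-complement-⊆ f w u = ⊆-trans (Θ-fuel-⊆ f (complement w) (complement-Unique u)) (complement-⊆ u)

evenDepthFlags-Θ-fuel : ∀ f w → length w ≤ f → Unique w →
                        evenDepthFlags (Θ-fuel f w) ≡ descFlagsEndingWith false w
evenDepthFlags-Θ-fuel zero    []      _  _ = refl
evenDepthFlags-Θ-fuel (suc f) w |w|≤ u with minimumSplit w u
... | empty = refl
... | split σ m τ m<σ m<τ uσ uτ unfold = begin
  evenDepthFlags (Θ-fuel (suc f) (σ ++ m ∷ τ))
    ≡⟨ cong evenDepthFlags (unfold f) ⟩
  evenDepthFlags (α ++ m ∷ β)
    ≡⟨ evenDepthFlags-++-minimum α β m<α m<β ⟩
  map not (evenDepthFlags α) ++ false ∷ evenDepthFlags β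
    ≡⟨ cong₂ (λ l r → map not l ++ false ∷ r) IHσ IHτ ⟩
  map not (descFlagsEndingWith false (complement σ)) ++ false ∷ descFlagsEndingWith false τ
    ≡⟨ cong (_++ false ∷ descFlagsEndingWith false τ)
            (descFlagsEndingWith-antitone (mirror-antitone uσ) uσ) ⟨
  descFlagsEndingWith true σ ++ false ∷ descFlagsEndingWith false τ
    ≡⟨ descFlagsEndingWith-++-minimum σ τ m<σ m<τ ⟨
  descFlagsEndingWith false (σ ++ m ∷ τ) ∎
  where
  α = Θ-fuel f (complement σ)
  β = Θ-fuel f τ
  m<α : All (m <_) α
  m<α = All-resp-⊇ (Θ-fuel-complement-⊆ f σ uσ) m<σ
  m<β : All (m <_) β
  m<β = All-resp-⊇ (Θ-fuel-⊆ f τ uτ) m<τ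
  |σ|+|τ|≤f : length (σ ++ τ) ≤ f
  |σ|+|τ|≤f = ≤-pred (subst (_≤ suc f) (length-++-sucʳ σ m τ) |w|≤)
  IHσ : evenDepthFlags α ≡ descFlagsEndingWith false (complement σ)
  IHσ = evenDepthFlags-Θ-fuel f (complement σ)
          (subst (_≤ f) (sym (length-map (mirror σ) σ)) (≤-trans (length-++-≤ˡ σ) |σ|+|τ|≤f))
          (complement-Unique uσ)
  IHτ : evenDepthFlags β ≡ descFlagsEndingWith false τ
  IHτ = evenDepthFlags-Θ-fuel f τ (≤-trans (length-++-≤ʳ τ {σ}) |σ|+|τ|≤f) uτ

evenDepthFlags-Θ : ∀ {w} → Unique w → evenDepthFlags (Θ w) ≡ descFlagsEndingWith false w
evenDepthFlags-Θ {w} = evenDepthFlags-Θ-fuel (length w) w ≤-refl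

length-Θ : ∀ {w} → Unique w → length (Θ w) ≡ length w
length-Θ {w} u = begin
  length (Θ w)                            ≡⟨ length-depths (Θ w) ⟨
  length (depths (Θ w))                   ≡⟨ length-map isEven (depths (Θ w)) ⟨
  length (evenDepthFlags (Θ w))           ≡⟨ cong length (evenDepthFlags-Θ u) ⟩
  length (descFlagsEndingWith false w)    ≡⟨ length-descFlagsEndingWith false w ⟩
  length w                                ∎

-- The identity holds for the empty permutation as well.
theorem8p1 : (n : ℕ) → 1 ≤ n → (π : List ℕ) → π ↭ map suc (upTo n) → EV (Θ π) ≡ Des π
theorem8p1 n _ π π↭[1,n] = begin
  EV (Θ π)
    ≡⟨ cong₂ (λ k flags → filterIdx (zip (map suc (upTo k)) flags)) (length-Θ uπ) (evenDepthFlags-Θ uπ) ⟩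
  filterIdx (zip (map suc (upTo (length π))) (descFlagsEndingWith false π))
    ≡⟨ filterIdx-descFlagsEndingWith-false (map suc (upTo (length π))) π ⟩
  Des π ∎
  where
  uπ : Unique π
  uπ = Unique-resp-↭ (↭⇒↭ₛ (↭-sym π↭[1,n])) (Unique.map⁺ suc-injective (Unique.upTo⁺ n))
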